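{- Let $n\ge 2$ and let $\Omega=(V_1,\ldots,V_n,E)$ be an octahedral system without isolated vertex. Then $|E|\ge\max_{i\neq j}(|V_i|+|V_j|)-2$.
   Context: An $n$-uniform hypergraph is $n$-partite if its vertex set is the disjoint union of $n$ sets $V_1,\ldots,V_n$ and each edge meets each $V_i$ in exactly one vertex; it is written $(V_1,\ldots,V_n,E)$. An octahedral system is such a hypergraph with $|V_i|\ge 2$ for all $i$ satisfying the parity condition: for every $X\subseteq\bigcup_i V_i$ with $|X\cap V_i|=2$ for all $i$, the number of edges contained in $X$ is even. A vertex is isolated if it belongs to no edge. -}

module Defs where

open import Data.Nat using (ℕ; _≤_)
open import Data.Nat.Divisibility using (_∣_)
open import Data.Fin using (Fin)
open import Data.Fin.Properties using (all?)
open import Data.List using (List; length; filter)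
open import Data.List.Relation.Unary.Any using (Any)
open import Data.List.Relation.Unary.AllPairs using (AllPairs)
open import Data.Sum using (_⊎_)
open import Data.Product using (_×_)
open import Relation.Nullary using (¬_)
open import Relation.Nullary.Decidable using (_⊎-dec_)
open import Relation.Binary.PropositionalEquality using (_≡_; _≢_)
open import Data.Fin using (_≟_)

-- An n-partite n-uniform hypergraph: the vertex class V_i is Fin (m i)
-- (classes are disjoint by construction); an edge picks exactly one
-- vertex from each class.
Edge : (n : ℕ) → (Fin n → ℕ) → Set
Edge n m = (i : Fin n) → Fin (m i)

SameEdge : ∀ {n m} → Edge n m → Edge n m → Set
SameEdge e f = ∀ i → e i ≡ f i

record Hypergraph (n : ℕ) (m : Fin n → ℕ) : Set where
  field
    edges    : List (Edge n m)
    distinct : AllPairs (λ e f → ¬ SameEdge e f) edges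

open Hypergraph public

-- A set X with |X ∩ V_i| = 2 for all i, given by two distinct vertices
-- a i ≠ b i of each class V_i.
record TwoPerClass (n : ℕ) (m : Fin n → ℕ) : Set where
  field
    fst   : (i : Fin n) → Fin (m i)
    snd   : (i : Fin n) → Fin (m i)
    fst≢snd : ∀ i → fst i ≢ snd i

open TwoPerClass public

_⊆X_ : ∀ {n m} → Edge n m → TwoPerClass n m → Set
e ⊆X X = ∀ i → (e i ≡ fst X i) ⊎ (e i ≡ snd X i)

edgesIn : ∀ {n m} → Hypergraph n m → TwoPerClass n m → ℕ
edgesIn H X = length (filter (λ e → all? (λ i → (e i ≟ fst X i) ⊎-dec (e i ≟ snd X i))) (edges H))

IsOctahedral : ∀ {n m} → Hypergraph n m → Set
IsOctahedral {n} {m} H =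
  (∀ i → 2 ≤ m i) × (∀ (X : TwoPerClass n m) → 2 ∣ edgesIn H X)

NoIsolatedVertex : ∀ {n m} → Hypergraph n m → Set
NoIsolatedVertex {n} {m} H = ∀ (i : Fin n) (v : Fin (m i)) → Any (λ e → e i ≡ v) (edges H)

-- Fix two distinct classes i and j and project the edge list onto them:
-- M x y is the number of edges through the vertex x of V_i and the vertex
-- y of V_j.  Then |E| is the total of the (|V_i| × |V_j|)-matrix M, no
-- isolated vertex means that no row or column of M vanishes, and the
-- parity condition, applied to a suitable X with two vertices per class,
-- forbids a "lonely one": an entry M a b = 1 whose 2×2 completions
-- M a y, M x b, M x y all vanish.
--
-- The theorem is thus a statement about natural-number matrices
-- (matrixBound): with nonzero rows and columns and no lonely one, the
-- total is at least p + q - 2.  If no entry equals 1, rows and columns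
-- have sum at least 2, giving total ≥ p + q.  Otherwise take an entry
-- M a b = 1; every row x with M x b = 0 is nonzero in every column where
-- row a vanishes, and summing row lower bounds (pivotBound) gives the
-- claim, after transposing when column b has no zero.

module Submission where

open import Defs
open import Data.Nat using (ℕ; zero; suc; _≤_; _∸_; _+_; _*_; z≤n; s≤s)
open import Data.Nat.Properties
  using ( +-*-semiring; +-comm; +-assoc; +-suc; *-identityˡ; *-identityʳ
        ; ≤-trans; ≤-reflexive; ≤-antisym; ≤-total; n≤1+n
        ; +-mono-≤; +-monoˡ-≤; +-monoʳ-≤; +-cancelʳ-≤
        ; m≤m+n; m≤n+m; n≢0⇒n>0; m≤n+o⇒m∸n≤o; module ≤-Reasoning )
  renaming (_≟_ to _≟ℕ_)
open import Data.Nat.Divisibility using (_∣_; ∣1⇒≡1)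
open import Data.Nat.Tactic.RingSolver using (solve-∀)
open import Data.Fin using (Fin; zero; suc; _≟_)
open import Data.Fin.Properties using (suc-injective; any?)
open import Data.List using (List; []; _∷_; length; filter)
open import Data.List.Properties using (filter-accept; filter-reject; filter-some)
open import Data.List.Membership.Propositional using (_∈_; find; lose)
open import Data.List.Membership.Propositional.Properties using (∈-filter⁻)
open import Data.List.Relation.Unary.Any using (here; there)
open import Data.Product using (∃-syntax; _×_; _,_; proj₁; proj₂)
open import Data.Sum using (_⊎_; inj₁; inj₂; map₂; [_,_]′)
open import Data.Empty using (⊥-elim)
open import Function using (_∘_)
open import Relation.Nullary using (¬_; yes; no)
open import Relation.Nullary.Decidable using (_×-dec_)
open import Relation.Unary using (Pred; Decidable)
open import Relation.Binary.PropositionalEquality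
  using (_≡_; _≢_; refl; sym; trans; cong; cong₂; subst; subst₂; module ≡-Reasoning)
open import Algebra.Properties.Semiring.Sum +-*-semiring
  using (sum; sum-syntax; sum-cong-≗; sum-replicate-zero; ∑-distrib-+; ∑-comm; *-distribʳ-sum)

sum-mono : ∀ {p} {f g : Fin p → ℕ} → (∀ x → f x ≤ g x) → sum f ≤ sum g
sum-mono {zero}  f≤g = z≤n
sum-mono {suc p} f≤g = +-mono-≤ (f≤g zero) (sum-mono (f≤g ∘ suc))

sum-const : ∀ p c → ∑[ x < p ] c ≡ p * c
sum-const zero    c = refl
sum-const (suc p) c = cong (c +_) (sum-const p c)

term≤sum : ∀ {p} (f : Fin p → ℕ) x → f x ≤ sum f
term≤sum f zero    = m≤m+n (f zero) _
term≤sum f (suc x) = ≤-trans (term≤sum (f ∘ suc) x) (m≤n+m _ (f zero))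

sum-bump : ∀ {p} (g h : Fin p → ℕ) (c : Fin p) →
           g c ≡ suc (h c) → (∀ x → x ≢ c → g x ≡ h x) → sum g ≡ suc (sum h)
sum-bump g h zero gc others = cong₂ _+_ gc (sum-cong-≗ (λ x → others (suc x) λ ()))
sum-bump g h (suc c) gc others = begin
  g zero + sum (g ∘ suc)
    ≡⟨ cong₂ _+_ (others zero λ ()) (sum-bump (g ∘ suc) (h ∘ suc) c gc others′) ⟩
  h zero + suc (sum (h ∘ suc))
    ≡⟨ +-suc (h zero) _ ⟩
  suc (sum h) ∎
  where
  open ≡-Reasoning
  others′ : ∀ x → x ≢ c → g (suc x) ≡ h (suc x)
  others′ x x≢c = others (suc x) (x≢c ∘ suc-injective)

sum-mono-except : ∀ {p} {f g : Fin p → ℕ} (a : Fin p) →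
                  (∀ x → x ≢ a → f x ≤ g x) → sum f + g a ≤ sum g + f a
sum-mono-except {f = f} {g} zero f≤g = begin
  f zero + sum (f ∘ suc) + g zero  ≡⟨ swap-outer (f zero) _ (g zero) ⟩
  g zero + sum (f ∘ suc) + f zero  ≤⟨ +-monoˡ-≤ (f zero) (+-monoʳ-≤ (g zero) rest) ⟩
  g zero + sum (g ∘ suc) + f zero  ∎
  where
  open ≤-Reasoning
  swap-outer : ∀ u v w → u + v + w ≡ w + v + u
  swap-outer = solve-∀
  rest : sum (f ∘ suc) ≤ sum (g ∘ suc)
  rest = sum-mono (λ x → f≤g (suc x) λ ())
sum-mono-except {f = f} {g} (suc a) f≤g = begin
  f zero + sum (f ∘ suc) + g (suc a)    ≡⟨ +-assoc (f zero) _ _ ⟩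
  f zero + (sum (f ∘ suc) + g (suc a))  ≤⟨ +-mono-≤ (f≤g zero λ ()) rest ⟩
  g zero + (sum (g ∘ suc) + f (suc a))  ≡⟨ +-assoc (g zero) _ _ ⟨
  g zero + sum (g ∘ suc) + f (suc a)    ∎
  where
  open ≤-Reasoning
  rest : sum (f ∘ suc) + g (suc a) ≤ sum (g ∘ suc) + f (suc a)
  rest = sum-mono-except a (λ x x≢a → f≤g (suc x) (x≢a ∘ suc-injective))

Matrix : ℕ → ℕ → Set
Matrix p q = Fin p → Fin q → ℕ

transpose : ∀ {p q} → Matrix p q → Matrix q p
transpose M y x = M x y

isZero : ℕ → ℕ
isZero zero    = 1
isZero (suc _) = 0

1≤k+isZero : ∀ k → 1 ≤ k + isZero k
1≤k+isZero zero    = s≤s z≤n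
1≤k+isZero (suc k) = s≤s z≤n

module _ {p q : ℕ} (M : Matrix p q) where

  rowSum : Fin p → ℕ
  rowSum x = ∑[ y < q ] M x y

  total : ℕ
  total = ∑[ x < p ] rowSum x

  zerosInRow : Fin p → ℕ
  zerosInRow a = ∑[ y < q ] isZero (M a y)

  zerosInCol : Fin q → ℕ
  zerosInCol b = ∑[ x < p ] isZero (M x b)

  NonzeroRows : Set
  NonzeroRows = ∀ x → ∃[ y ] 1 ≤ M x y

  NoLonelyOne : Set
  NoLonelyOne = ∀ {a b x y} → M a b ≡ 1 → M x b ≡ 0 → M a y ≡ 0 → 1 ≤ M x y

total-transpose : ∀ {p q} (M : Matrix p q) → total (transpose M) ≡ total M
total-transpose M = sym (∑-comm M)

noLonelyOne-transpose : ∀ {p q} {M : Matrix p q} → NoLonelyOne M → NoLonelyOne (transpose M)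
noLonelyOne-transpose lonely {a} {b} {x} {y} ab bx ya = lonely {b} {a} {y} {x} ab ya bx

total≥ : ∀ {p q} (M : Matrix p q) {c} → (∀ x → c ≤ rowSum M x) → p * c ≤ total M
total≥ {p} M {c} rows≥ = ≤-trans (≤-reflexive (sym (sum-const p c))) (sum-mono rows≥)

rowSum-pos : ∀ {p q} (M : Matrix p q) → NonzeroRows M → ∀ x → 1 ≤ rowSum M x
rowSum-pos M rows x = ≤-trans (proj₂ (rows x)) (term≤sum (M x) (proj₁ (rows x)))

≥1∧≢1⇒≥2 : ∀ {k} → 1 ≤ k → k ≢ 1 → 2 ≤ k
≥1∧≢1⇒≥2 {suc zero}    _ k≢1 = ⊥-elim (k≢1 refl)
≥1∧≢1⇒≥2 {suc (suc k)} _ _   = s≤s (s≤s z≤n)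

+≤-from-doubles : ∀ p q {T} → p * 2 ≤ T → q * 2 ≤ T → p + q ≤ T
+≤-from-doubles p q {T} p2≤T q2≤T =
  [ (λ p≤q → ≤-trans (+-monoˡ-≤ q p≤q) (twice≤ q q2≤T))
  , (λ q≤p → ≤-trans (+-monoʳ-≤ p q≤p) (twice≤ p p2≤T)) ]′ (≤-total p q)
  where
  k+k≡k*2 : ∀ k → k + k ≡ k * 2
  k+k≡k*2 = solve-∀
  twice≤ : ∀ k → k * 2 ≤ T → k + k ≤ T
  twice≤ k = ≤-trans (≤-reflexive (k+k≡k*2 k))

-- Without entries equal to 1, every nonzero row and column sums to at
-- least 2, so the total is at least p + q.
noOneBound : ∀ {p q} (M : Matrix p q) → NonzeroRows M → NonzeroRows (transpose M) →
             (∀ x y → M x y ≢ 1) → p + q ≤ total M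
noOneBound {p} {q} M rows cols noOne = +≤-from-doubles p q rowBound colBound
  where
  rowBound : p * 2 ≤ total M
  rowBound = total≥ M λ x → let (y , xy) = rows x in
    ≤-trans (≥1∧≢1⇒≥2 xy (noOne x y)) (term≤sum (M x) y)
  colBound : q * 2 ≤ total M
  colBound = subst (q * 2 ≤_) (total-transpose M) (total≥ (transpose M) λ y →
    let (x , xy) = cols y in ≤-trans (≥1∧≢1⇒≥2 xy (noOne x y)) (term≤sum (transpose M y) x))

-- Each column either meets row a in a nonzero entry or is a zero of row a.
pivotRow≥ : ∀ {p q} (M : Matrix p q) a → q ≤ rowSum M a + zerosInRow M a
pivotRow≥ {q = q} M a = begin
  q                                    ≡⟨ trans (sum-const q 1) (*-identityʳ q) ⟨
  ∑[ y < q ] 1                         ≤⟨ sum-mono (λ y → 1≤k+isZero (M a y)) ⟩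
  ∑[ y < q ] (M a y + isZero (M a y))  ≡⟨ ∑-distrib-+ (M a) _ ⟩
  rowSum M a + zerosInRow M a          ∎
  where open ≤-Reasoning

module Pivot {p q} (M : Matrix p q) (rows : NonzeroRows M) (lonely : NoLonelyOne M)
             {a : Fin p} {b : Fin q} (ab : M a b ≡ 1) where

  α β : ℕ
  α = zerosInCol M b
  β = zerosInRow M a

  -- A row x with M x b = 0 is nonzero wherever row a vanishes.
  blockedRow≥ : ∀ {x} → M x b ≡ 0 → β ≤ rowSum M x
  blockedRow≥ {x} xb = sum-mono entry
    where
    entry : ∀ y → isZero (M a y) ≤ M x y
    entry y with M a y in ay
    ... | zero  = lonely ab xb ay
    ... | suc _ = z≤n

  -- lower bound for the sum of row x: 1, or max 1 β if M x b = 0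
  rowBound : Fin p → ℕ
  rowBound x = 1 + isZero (M x b) * (β ∸ 1)

  rowBound≤rowSum : ∀ x → rowBound x ≤ rowSum M x
  rowBound≤rowSum x with M x b in xb
  ... | suc _ = rowSum-pos M rows x
  ... | zero  = ≤-trans (≤-reflexive (cong suc (*-identityˡ (β ∸ 1))))
                        (max1β (rowSum-pos M rows x) (blockedRow≥ xb))
    where
    max1β : ∀ {r} → 1 ≤ r → β ≤ r → 1 + (β ∸ 1) ≤ r
    max1β with β
    ... | zero  = λ 1≤r _ → 1≤r
    ... | suc _ = λ _ β≤r → β≤r

  sum-rowBound : sum rowBound ≡ p + α * (β ∸ 1)
  sum-rowBound = begin
    ∑[ x < p ] (1 + isZero (M x b) * (β ∸ 1))
      ≡⟨ ∑-distrib-+ (λ _ → 1) (λ x → isZero (M x b) * (β ∸ 1)) ⟩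
    ∑[ x < p ] 1 + ∑[ x < p ] (isZero (M x b) * (β ∸ 1))
      ≡⟨ cong₂ _+_ (sym ones) (*-distribʳ-sum (β ∸ 1) (λ x → isZero (M x b))) ⟨
    p + α * (β ∸ 1) ∎
    where
    open ≡-Reasoning
    ones : ∑[ x < p ] 1 ≡ p
    ones = trans (sum-const p 1) (*-identityʳ p)

  -- Row a accounts for q - β, every other row for rowBound.
  pivotBound : p + q + α * (β ∸ 1) ≤ total M + 1 + β
  pivotBound = begin
    p + q + α * (β ∸ 1)
      ≡⟨ swap-last p q _ ⟩
    p + α * (β ∸ 1) + q
      ≡⟨ cong (_+ q) sum-rowBound ⟨
    sum rowBound + q
      ≤⟨ +-monoʳ-≤ (sum rowBound) (pivotRow≥ M a) ⟩
    sum rowBound + (rowSum M a + β)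
      ≡⟨ +-assoc (sum rowBound) _ _ ⟨
    sum rowBound + rowSum M a + β
      ≤⟨ +-monoˡ-≤ β (sum-mono-except a λ x _ → rowBound≤rowSum x) ⟩
    total M + rowBound a + β
      ≡⟨ cong (λ e → total M + (1 + isZero e * (β ∸ 1)) + β) ab ⟩
    total M + 1 + β ∎
    where
    open ≤-Reasoning
    swap-last : ∀ u v w → u + v + w ≡ u + w + v
    swap-last = solve-∀

pivotArith : ∀ s T α β → s + α * (β ∸ 1) ≤ T + 1 + β → 1 ≤ α ⊎ β ≡ 0 → s ≤ 2 + T
pivotArith s T α zero bound _ = begin
  s            ≤⟨ m≤m+n s _ ⟩
  s + α * 0    ≤⟨ bound ⟩
  T + 1 + 0    ≡⟨ tidy T ⟩
  1 + T        ≤⟨ n≤1+n _ ⟩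
  2 + T        ∎
  where
  open ≤-Reasoning
  tidy : ∀ t → t + 1 + 0 ≡ 1 + t
  tidy = solve-∀
pivotArith s T (suc α) (suc β) bound _ = +-cancelʳ-≤ β s (2 + T) (begin
  s + β               ≤⟨ +-monoʳ-≤ s (m≤m+n β (α * β)) ⟩
  s + (β + α * β)     ≤⟨ bound ⟩
  T + 1 + suc β       ≡⟨ tidy T β ⟩
  2 + T + β           ∎)
  where
  open ≤-Reasoning
  tidy : ∀ t u → t + 1 + suc u ≡ 2 + t + u
  tidy = solve-∀
pivotArith s T zero (suc β) bound (inj₁ ())
pivotArith s T α    (suc β) bound (inj₂ ())

-- Given M a b = 1: apply pivotBound to M if column b has a zero, and to
-- the transpose (whose row a then has no zero) otherwise.
lonelyOneBound : ∀ {p q} (M : Matrix p q) → NonzeroRows M → NonzeroRows (transpose M) →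
                 NoLonelyOne M → ∀ {a b} → M a b ≡ 1 → p + q ≤ 2 + total M
lonelyOneBound {p} {q} M rows cols lonely {a} {b} ab with zerosInCol M b ≟ℕ 0
... | no α≢0 = pivotArith (p + q) (total M) (zerosInCol M b) (zerosInRow M a)
                          (Pivot.pivotBound M rows lonely ab)
                          (inj₁ (n≢0⇒n>0 α≢0))
... | yes α≡0 = subst₂ _≤_ (+-comm q p) (cong (2 +_) (total-transpose M))
                  (pivotArith (q + p) (total (transpose M)) (zerosInRow M a) (zerosInCol M b)
                     (Pivot.pivotBound (transpose M) cols
                     (noLonelyOne-transpose {M = M} lonely) {b} {a} ab) (inj₂ α≡0))

matrixBound : ∀ {p q} (M : Matrix p q) → NonzeroRows M → NonzeroRows (transpose M) →
              NoLonelyOne M → p + q ≤ 2 + total M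
matrixBound M rows cols lonely with any? (λ x → any? (λ y → M x y ≟ℕ 1))
... | yes (a , b , ab) = lonelyOneBound M rows cols lonely ab
... | no noOne = ≤-trans (noOneBound M rows cols λ x y xy → noOne (x , y , xy)) (m≤n+m _ 2)

filter-witness : ∀ {A : Set} {P : A → Set} (P? : Decidable P) {xs : List A} →
                 1 ≤ length (filter P? xs) → ∃[ v ] v ∈ xs × P v
filter-witness P? {xs} nonempty with filter P? xs in eq
... | v ∷ _ = v , ∈-filter⁻ P? (subst (v ∈_) (sym eq) (here refl))

filter-length-mono : ∀ {A : Set} {P Q : A → Set} (P? : Decidable P) (Q? : Decidable Q) {xs} →
                     (∀ {v} → v ∈ xs → P v → Q v) →
                     length (filter P? xs) ≤ length (filter Q? xs)
filter-length-mono P? Q? {[]}     P⇒Q = z≤n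
filter-length-mono P? Q? {v ∷ xs} P⇒Q with P? v | Q? v
... | yes _  | yes _  = s≤s (filter-length-mono P? Q? (P⇒Q ∘ there))
... | yes pv | no ¬qv = ⊥-elim (¬qv (P⇒Q (here refl) pv))
... | no _   | yes _  = ≤-trans (filter-length-mono P? Q? (P⇒Q ∘ there)) (n≤1+n _)
... | no _   | no _   = filter-length-mono P? Q? (P⇒Q ∘ there)

module Projection {n : ℕ} {m : Fin n → ℕ} (i j : Fin n) where

  InCell : Fin (m i) → Fin (m j) → Pred (Edge n m) _
  InCell x y e = e i ≡ x × e j ≡ y

  inCell? : ∀ x y → Decidable (InCell x y)
  inCell? x y e = (e i ≟ x) ×-dec (e j ≟ y)

  cellCount : List (Edge n m) → Matrix (m i) (m j)
  cellCount L x y = length (filter (inCell? x y) L)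

  -- Every edge lies in exactly one cell.
  total-cellCount : ∀ L → total (cellCount L) ≡ length L
  total-cellCount []      =
    trans (sum-cong-≗ {m i} (λ _ → sum-replicate-zero (m j))) (sum-replicate-zero (m i))
  total-cellCount (e ∷ L) =
    trans (sum-bump (rowSum (cellCount (e ∷ L))) (rowSum (cellCount L)) (e i) ownRow otherRow)
          (cong suc (total-cellCount L))
    where
    ownCell : cellCount (e ∷ L) (e i) (e j) ≡ suc (cellCount L (e i) (e j))
    ownCell = cong length (filter-accept (inCell? (e i) (e j)) {e} {L} (refl , refl))
    ownRow : rowSum (cellCount (e ∷ L)) (e i) ≡ suc (rowSum (cellCount L) (e i))
    ownRow = sum-bump (cellCount (e ∷ L) (e i)) (cellCount L (e i)) (e j) ownCell
               λ y y≢ej →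
                 cong length (filter-reject (inCell? (e i) y) {e} {L} (y≢ej ∘ sym ∘ proj₂))
    otherRow : ∀ x → x ≢ e i → rowSum (cellCount (e ∷ L)) x ≡ rowSum (cellCount L) x
    otherRow x x≢ei = sum-cong-≗ {m j} λ y →
      cong length (filter-reject (inCell? x y) {e} {L} (x≢ei ∘ sym ∘ proj₁))

  occupied : ∀ {L e x y} → e ∈ L → InCell x y e → 1 ≤ cellCount L x y
  occupied e∈L inCell = filter-some (inCell? _ _) (lose e∈L inCell)

  empty-cell : ∀ {L e x y} → cellCount L x y ≡ 0 → e ∈ L → ¬ InCell x y e
  empty-cell xy≡0 e∈L inCell with () ← subst (1 ≤_) xy≡0 (occupied e∈L inCell)

  nonzeroRows : ∀ {L} → (∀ x → ∃[ e ] e ∈ L × e i ≡ x) → NonzeroRows (cellCount L)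
  nonzeroRows cover x = let (e , e∈L , eix) = cover x in e j , occupied e∈L (eix , refl)

  nonzeroCols : ∀ {L} → (∀ y → ∃[ e ] e ∈ L × e j ≡ y) →
                NonzeroRows (transpose (cellCount L))
  nonzeroCols cover y = let (e , e∈L , ejy) = cover y in e i , occupied e∈L (refl , ejy)

otherVertex : ∀ {r} → 2 ≤ r → Fin r → Fin r
otherVertex (s≤s (s≤s _)) zero    = suc zero
otherVertex (s≤s (s≤s _)) (suc _) = zero

otherVertex-≢ : ∀ {r} (r≥2 : 2 ≤ r) v → v ≢ otherVertex r≥2 v
otherVertex-≢ (s≤s (s≤s _)) zero    ()
otherVertex-≢ (s≤s (s≤s _)) (suc _) ()

-- The square through the edge e and the vertices x ∈ V_i, y ∈ V_j: it
-- consists of e together with x, y and an arbitrary second vertex of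
-- each remaining class.
module Square {n : ℕ} {m : Fin n → ℕ} (classes≥2 : ∀ k → 2 ≤ m k)
              {i j : Fin n} (i≢j : i ≢ j) (e : Edge n m)
              {x : Fin (m i)} {y : Fin (m j)} (ei≢x : e i ≢ x) (ej≢y : e j ≢ y) where

  partner : Edge n m
  partner k with k ≟ i | k ≟ j
  ... | yes refl | _        = x
  ... | no _     | yes refl = y
  ... | no _     | no _     = otherVertex (classes≥2 k) (e k)

  partner-i : partner i ≡ x
  partner-i with i ≟ i
  ... | yes refl = refl
  ... | no i≢i   = ⊥-elim (i≢i refl)

  partner-j : partner j ≡ y
  partner-j with j ≟ i | j ≟ j
  ... | yes j≡i | _        = ⊥-elim (i≢j (sym j≡i))
  ... | no _    | yes refl = refl
  ... | no _    | no j≢j   = ⊥-elim (j≢j refl)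

  e≢partner : ∀ k → e k ≢ partner k
  e≢partner k with k ≟ i | k ≟ j
  ... | yes refl | _        = ei≢x
  ... | no _     | yes refl = ej≢y
  ... | no _     | no _     = otherVertex-≢ (classes≥2 k) (e k)

  square : TwoPerClass n m
  square = record { fst = e ; snd = partner ; fst≢snd = e≢partner }

  onSquare-i : ∀ {f} → f ⊆X square → f i ≡ e i ⊎ f i ≡ x
  onSquare-i f⊆ = map₂ (λ fi≡ → trans fi≡ partner-i) (f⊆ i)

  onSquare-j : ∀ {f} → f ⊆X square → f j ≡ e j ⊎ f j ≡ y
  onSquare-j f⊆ = map₂ (λ fj≡ → trans fj≡ partner-j) (f⊆ j)

-- If M a b = 1 and M x b = M a y = M x y = 0, the square through the
-- unique edge of cell (a, b) and x, y contains exactly one edge.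
octahedral⇒noLonelyOne : ∀ {n} {m : Fin n → ℕ} (H : Hypergraph n m) {i j : Fin n} → i ≢ j →
                         IsOctahedral H → NoLonelyOne (Projection.cellCount i j (edges H))
octahedral⇒noLonelyOne {n} {m} H {i} {j} i≢j (classes≥2 , even) {a} {b} {x} {y} ab xb ay =
  n≢0⇒n>0 xy≢0
  where
  open Projection i j
  L : List (Edge n m)
  L = edges H
  vacant : ∀ {f u v} → cellCount L u v ≡ 0 → f ∈ L → ¬ InCell u v f
  vacant = empty-cell
  pivotEdge : ∃[ f ] f ∈ L × InCell a b f
  pivotEdge = filter-witness (inCell? a b) (≤-reflexive (sym ab))
  e : Edge n m
  e = proj₁ pivotEdge
  e∈L : e ∈ L
  e∈L = proj₁ (proj₂ pivotEdge)
  eia : e i ≡ a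
  eia = proj₁ (proj₂ (proj₂ pivotEdge))
  ejb : e j ≡ b
  ejb = proj₂ (proj₂ (proj₂ pivotEdge))

  open Square classes≥2 i≢j e (λ eix → vacant xb e∈L (eix , ejb))
                              (λ ejy → vacant ay e∈L (eia , ejy))

  xy≢0 : cellCount L x y ≢ 0
  xy≢0 xy = 2≢1 (∣1⇒≡1 (subst (2 ∣_) exactlyOne (even square)))
    where
    2≢1 : 2 ≢ 1
    2≢1 ()
    inPivotCell : ∀ {f} → f ∈ L → f ⊆X square → InCell a b f
    inPivotCell {f} f∈L f⊆ with onSquare-i f⊆ | onSquare-j f⊆
    ... | inj₁ fi | inj₁ fj = trans fi eia , trans fj ejb
    ... | inj₁ fi | inj₂ fj = ⊥-elim (vacant ay f∈L (trans fi eia , fj))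
    ... | inj₂ fi | inj₁ fj = ⊥-elim (vacant xb f∈L (fi , trans fj ejb))
    ... | inj₂ fi | inj₂ fj = ⊥-elim (vacant xy f∈L (fi , fj))
    exactlyOne : edgesIn H square ≡ 1
    exactlyOne = ≤-antisym
      (≤-trans (filter-length-mono _ (inCell? a b) inPivotCell) (≤-reflexive ab))
      (filter-some _ (lose e∈L λ _ → inj₁ refl))

proposition2p3 : (n : ℕ) → 2 ≤ n → (m : Fin n → ℕ) → (H : Hypergraph n m)
               → IsOctahedral H → NoIsolatedVertex H
               → ∀ (i j : Fin n) → i ≢ j → (m i + m j) ∸ 2 ≤ length (edges H)
proposition2p3 n _ m H octahedral noIsolated i j i≢j =
  m≤n+o⇒m∸n≤o (m i + m j) 2 (begin
    m i + m j     ≤⟨ matrixBound M rows cols (octahedral⇒noLonelyOne H i≢j octahedral) ⟩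
    2 + total M   ≡⟨ cong (2 +_) (total-cellCount (edges H)) ⟩
    2 + length (edges H) ∎)
  where
  open Projection i j
  open ≤-Reasoning
  M : Matrix (m i) (m j)
  M = cellCount (edges H)
  rows : NonzeroRows M
  rows = nonzeroRows (find ∘ noIsolated i)
  cols : NonzeroRows (transpose M)
  cols = nonzeroCols (find ∘ noIsolated j)
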